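{- Let $n,k\in\mathbb{N}$ with $k\ge 2$, and let $f_j=1/j$ for $j\in[n]$. Let $h_1,\dots,h_k:[n]\to[n]$ be independent, truly (uniformly) random hash functions (i.e. the number of buckets equals $n$). For $i\in[n]$ define $$\tilde f_i=\min_{\ell\in[k]}\Big(\sum_{j\in[n]}[h_\ell(j)=h_\ell(i)]\,f_j\Big).$$ Then for every $i\in[n]$, $\mathbb{E}[|\tilde f_i-f_i|]=O(1/n)$, with an absolute implied constant.
   Context: $[n]=\{1,\dots,n\}$; for an event $E$, $[E]\in\{0,1\}$ denotes its indicator. -}

module Defs where

open import Data.Nat as ℕ using (ℕ; zero; suc)
open import Data.Nat.Properties using (m^n≢0)
open import Data.Fin using (Fin; zero; suc; toℕ; _≟_)
open import Data.Integer using (+_)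
open import Data.Rational using (ℚ; 0ℚ; _+_; _-_; _*_; _/_; _⊓_; ∣_∣)
open import Relation.Nullary.Decidable using (does)
open import Data.Bool using (if_then_else_)

-- [n] is represented by Fin n, with index j : Fin n standing for toℕ j + 1.
-- f_j = 1/j
f : {n : ℕ} → Fin n → ℚ
f j = + 1 / suc (toℕ j)

sumFin : (m : ℕ) → (Fin m → ℚ) → ℚ
sumFin zero    g = 0ℚ
sumFin (suc m) g = g zero + sumFin m (λ a → g (suc a))

sumFun : {X : Set} → ((X → ℚ) → ℚ) → (n : ℕ) → ((Fin n → X) → ℚ) → ℚ
sumFun sX zero    g = g (λ ())
sumFun sX (suc n) g = sX (λ a → sumFun sX n (λ h → g (λ { zero → a ; (suc j) → h j })))

sumHash : (n : ℕ) → ((Fin n → Fin n) → ℚ) → ℚ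
sumHash n = sumFun (sumFin n) n

sumHashes : (n k : ℕ) → ((Fin k → Fin n → Fin n) → ℚ) → ℚ
sumHashes n k = sumFun (sumHash n) k

-- minimum over ℓ ∈ Fin k (only used with k ≥ 2; value 0 for k = 0 is irrelevant)
minFin : (k : ℕ) → (Fin k → ℚ) → ℚ
minFin zero          g = 0ℚ
minFin (suc zero)    g = g zero
minFin (suc (suc k)) g = g zero ⊓ minFin (suc k) (λ a → g (suc a))

ind : {n : ℕ} → Fin n → Fin n → ℚ
ind a b = if does (a ≟ b) then + 1 / 1 else 0ℚ

ftilde : (n k : ℕ) → (Fin k → Fin n → Fin n) → Fin n → ℚ
ftilde n k h i = minFin k (λ ℓ → sumFin n (λ j → ind (h ℓ j) (h ℓ i) * f j))

-- E[|f̃_i − f_i|] for independent uniformly random h_1..h_k : [n] → [n]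
-- = (1 / n^(n·k)) Σ_{all k-tuples h} |f̃_i − f_i|
expErr : (n k : ℕ) → .{{_ : ℕ.NonZero n}} → Fin n → ℚ
expErr n k {{nz}} i =
  (+ 1 / (n ℕ.^ (n ℕ.* k)) ) {{m^n≢0 n (n ℕ.* k)}}
  * sumHashes n k (λ h → ∣ ftilde n k h i - f i ∣)

module Submission where

-- Row ℓ overestimates f_i by X_ℓ = Σ_{j ≠ i} [h_ℓ j = h_ℓ i] f_j ≥ 0, hence
--   |f̃_i − f_i| = min_ℓ X_ℓ ≤ min (X_1, X_2) ≤ Σ_{j,j'} min (f_j, f_j') [h_1 j = h_1 i] [h_2 j' = h_2 i].
-- The hash functions h_1, h_2 are independent and a fixed j ≠ i collides with i with
-- probability 1/n, so E |f̃_i − f_i| ≤ n⁻² Σ_{j,j'} min (f_j, f_j') ≤ n⁻² · 2n = 2/n.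

open import Defs
open import Data.Nat using (ℕ; _≤_; NonZero)
open import Data.Fin using (Fin)
open import Data.Integer using (+_)
open import Data.Rational using (_/_) renaming (_≤_ to _≤ℚ_)
open import Data.Product using (∃)

open import Data.Nat as ℕ using (zero; suc)
open import Data.Fin using (zero; suc; toℕ; _≟_)
import Data.Nat.Properties as ℕP
import Data.Integer as ℤ
import Data.Integer.Properties as ℤP
open import Data.Rational using (ℚ; 0ℚ; 1ℚ; _+_; _*_; _-_; -_; _⊓_; ∣_∣; toℚᵘ; nonNegative)
open import Data.Rational.Properties hiding (_≟_)
import Data.Rational.Unnormalised as ℚᵘ
import Data.Rational.Unnormalised.Properties as ℚᵘP
open import Relation.Binary.PropositionalEquality
open import Function using (_∘_)
open import Data.Empty using (⊥-elim)
open import Data.Product using (_,_)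
open import Data.Sum using (_⊎_; inj₁; inj₂)
open import Data.Bool using (if_then_else_)
open import Relation.Nullary.Decidable using (does; yes; no)
open import Data.Nat.Tactic.RingSolver using (solve)
open import Data.List using ([]; _∷_)
open import Algebra.Bundles using (Ring; CommutativeMonoid)
open import Algebra.Properties.CommutativeSemigroup
  (CommutativeMonoid.commutativeSemigroup +-0-commutativeMonoid) using () renaming (interchange to +-interchange)
open import Algebra.Properties.Semiring.Exp (Ring.semiring +-*-ring) using (_^_; ^-assocʳ)

/-cross : ∀ i j a b → i ℤ.* + suc b ≡ j ℤ.* + suc a → i / suc a ≡ j / suc b
/-cross i j a b eq = toℚᵘ-injective (ℚᵘP.≃-trans (toℚᵘ-fromℚᵘ (ℚᵘ.mkℚᵘ i a))
  (ℚᵘP.≃-trans (ℚᵘ.*≡* eq) (ℚᵘP.≃-sym (toℚᵘ-fromℚᵘ (ℚᵘ.mkℚᵘ j b)))))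

/-*-/ : ∀ i j a b .{{_ : NonZero a}} .{{_ : NonZero b}} →
        (i / a) * (j / b) ≡ ((i ℤ.* j) / (a ℕ.* b)) {{ℕP.m*n≢0 a b}}
/-*-/ i j (suc a) (suc b) = toℚᵘ-injective (ℚᵘP.≃-trans (toℚᵘ-homo-* (i / suc a) (j / suc b))
  (ℚᵘP.≃-trans (ℚᵘP.*-cong (toℚᵘ-fromℚᵘ (ℚᵘ.mkℚᵘ i a)) (toℚᵘ-fromℚᵘ (ℚᵘ.mkℚᵘ j b)))
    (ℚᵘP.≃-sym (toℚᵘ-fromℚᵘ _))))

fromℕ : ℕ → ℚ
fromℕ m = + m / 1

fromℕ-suc : ∀ m → fromℕ (suc m) ≡ 1ℚ + fromℕ m
fromℕ-suc m = toℚᵘ-injective (ℚᵘP.≃-trans (toℚᵘ-fromℚᵘ (ℚᵘ.mkℚᵘ (+ suc m) 0))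
  (ℚᵘP.≃-trans (ℚᵘ.*≡* cross) (ℚᵘP.≃-sym (ℚᵘP.≃-trans (toℚᵘ-homo-+ 1ℚ (fromℕ m))
    (ℚᵘP.+-congʳ (toℚᵘ 1ℚ) (toℚᵘ-fromℚᵘ (ℚᵘ.mkℚᵘ (+ m) 0)))))))
  where
  cross : + suc m ℤ.* + 1 ≡ (+ 1 ℤ.+ + m ℤ.* + 1) ℤ.* + 1
  cross = trans (ℤP.*-identityʳ _) (sym (trans (ℤP.*-identityʳ _) (cong (λ z → + 1 ℤ.+ z) (ℤP.*-identityʳ (+ m)))))

fromℕ-nonNeg : ∀ m → 0ℚ ≤ℚ fromℕ m
fromℕ-nonNeg m = nonNegative⁻¹ (fromℕ m) {{normalize-nonNeg m 1}}

1/n*n≡1 : ∀ m → (+ 1 / suc m) * fromℕ (suc m) ≡ 1ℚ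
1/n*n≡1 m = trans (/-*-/ (+ 1) (+ suc m) (suc m) 1)
  (/-cross (+ 1 ℤ.* + suc m) (+ 1) (m ℕ.* 1) 0 (cong +_ cross))
  where
  cross : (1 ℕ.* suc m) ℕ.* 1 ≡ 1 ℕ.* suc (m ℕ.* 1)
  cross = solve (m ∷ [])

*-nonNeg : ∀ {a b} → 0ℚ ≤ℚ a → 0ℚ ≤ℚ b → 0ℚ ≤ℚ a * b
*-nonNeg {a} {b} 0≤a 0≤b = nonNegative⁻¹ (a * b) {{nonNeg*nonNeg⇒nonNeg a {{nonNegative 0≤a}} b {{nonNegative 0≤b}}}}

-- (1/n)² · (n + n) = 2/n; the closed sum 1 + 1 normalises to 2/1 by computation.
1/n²*2n≡2/n : ∀ m → (+ 1 / suc m * (+ 1 / suc m)) * (fromℕ (suc m) + fromℕ (suc m)) ≡ + 2 / suc m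
1/n²*2n≡2/n m = begin
  v * v * (N + N)         ≡⟨ *-assoc v v (N + N) ⟩
  v * (v * (N + N))       ≡⟨ cong (v *_) (*-distribˡ-+ v N N) ⟩
  v * (v * N + v * N)     ≡⟨ cong (λ x → v * (x + x)) (1/n*n≡1 m) ⟩
  v * (1ℚ + 1ℚ)           ≡⟨ /-*-/ (+ 1) (+ 2) (suc m) 1 ⟩
  + 2 / (suc m ℕ.* 1)     ≡⟨ /-cong {+ 2} {suc m ℕ.* 1} {+ 2} {suc m} refl (ℕP.*-identityʳ (suc m)) ⟩
  + 2 / suc m             ∎
  where
  open ≡-Reasoning
  v N : ℚ
  v = + 1 / suc m
  N = fromℕ (suc m)

*-mono-nonNeg : ∀ {a b c d} → 0ℚ ≤ℚ a → a ≤ℚ c → 0ℚ ≤ℚ b → b ≤ℚ d → a * b ≤ℚ c * d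
*-mono-nonNeg {a} {b} {c} {d} 0≤a a≤c 0≤b b≤d =
  ≤-trans (*-monoʳ-≤-nonNeg b {{nonNegative 0≤b}} a≤c)
          (*-monoˡ-≤-nonNeg c {{nonNegative (≤-trans 0≤a a≤c)}} b≤d)

1/n-nonNeg : ∀ n .{{_ : NonZero n}} → 0ℚ ≤ℚ + 1 / n
1/n-nonNeg n = nonNegative⁻¹ (+ 1 / n) {{normalize-nonNeg 1 n}}

1/n^e : ∀ n .{{_ : NonZero n}} e → (+ 1 / n) ^ e ≡ (+ 1 / (n ℕ.^ e)) {{ℕP.m^n≢0 n e}}
1/n^e n zero = refl
1/n^e n {{n≢0}} (suc e) = trans (cong (+ 1 / n *_) (1/n^e n e))
  (/-*-/ (+ 1) (+ 1) n (n ℕ.^ e) {{n≢0}} {{ℕP.m^n≢0 n e}})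

record IsSummation {X : Set} (S : (X → ℚ) → ℚ) : Set where
  field
    ext   : ∀ {g g' : X → ℚ} → (∀ x → g x ≡ g' x) → S g ≡ S g'
    +-hom : ∀ (g g' : X → ℚ) → S (λ x → g x + g' x) ≡ S g + S g'
    *-hom : ∀ c (g : X → ℚ) → S (λ x → c * g x) ≡ c * S g
    mono  : ∀ {g g' : X → ℚ} → (∀ x → g x ≤ℚ g' x) → S g ≤ℚ S g'

open IsSummation

sumFin-isSummation : ∀ m → IsSummation (sumFin m)
ext   (sumFin-isSummation zero)    _ = refl
ext   (sumFin-isSummation (suc m)) e = cong₂ _+_ (e zero) (ext (sumFin-isSummation m) (e ∘ suc))
+-hom (sumFin-isSummation zero)    _ _ = sym (+-identityʳ 0ℚ)
+-hom (sumFin-isSummation (suc m)) g g' =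
  trans (cong (_+_ (g zero + g' zero)) (+-hom (sumFin-isSummation m) (g ∘ suc) (g' ∘ suc)))
        (+-interchange (g zero) (g' zero) _ _)
*-hom (sumFin-isSummation zero)    c _ = sym (*-zeroʳ c)
*-hom (sumFin-isSummation (suc m)) c g =
  trans (cong (_+_ (c * g zero)) (*-hom (sumFin-isSummation m) c (g ∘ suc)))
        (sym (*-distribˡ-+ c (g zero) _))
mono  (sumFin-isSummation zero)    _  = ≤-refl
mono  (sumFin-isSummation (suc m)) le = +-mono-≤ (le zero) (mono (sumFin-isSummation m) (le ∘ suc))

sumFun-isSummation : ∀ {X : Set} {S : (X → ℚ) → ℚ} → IsSummation S → ∀ m → IsSummation (sumFun S m)
ext   (sumFun-isSummation L zero)    e = e _
ext   (sumFun-isSummation L (suc m)) e = ext L (λ a → ext (sumFun-isSummation L m) (λ h → e _))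
+-hom (sumFun-isSummation L zero)    g g' = refl
+-hom (sumFun-isSummation L (suc m)) g g' =
  trans (ext L (λ a → +-hom (sumFun-isSummation L m) _ _)) (+-hom L _ _)
*-hom (sumFun-isSummation L zero)    c g = refl
*-hom (sumFun-isSummation L (suc m)) c g =
  trans (ext L (λ a → *-hom (sumFun-isSummation L m) c _)) (*-hom L c _)
mono  (sumFun-isSummation L zero)    le = le _
mono  (sumFun-isSummation L (suc m)) le = mono L (λ a → mono (sumFun-isSummation L m) (λ h → le _))

module Summation {X : Set} {S : (X → ℚ) → ℚ} (L : IsSummation S) where

  S-zero : S (λ _ → 0ℚ) ≡ 0ℚ
  S-zero = trans (ext L (λ _ → sym (*-zeroˡ 0ℚ))) (trans (*-hom L 0ℚ (λ _ → 0ℚ)) (*-zeroˡ (S (λ _ → 0ℚ))))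

  S-nonNeg : ∀ {g : X → ℚ} → (∀ x → 0ℚ ≤ℚ g x) → 0ℚ ≤ℚ S g
  S-nonNeg h = ≤-trans (≤-reflexive (sym S-zero)) (mono L h)

  S-sumFin : ∀ m (F : Fin m → X → ℚ) → S (λ x → sumFin m (λ j → F j x)) ≡ sumFin m (λ j → S (F j))
  S-sumFin zero    F = S-zero
  S-sumFin (suc m) F = trans (+-hom L (F zero) (λ x → sumFin m (λ j → F (suc j) x)))
                             (cong (_+_ (S (F zero))) (S-sumFin m (F ∘ suc)))

open Summation

sumFun-scale : ∀ {X : Set} {S E : (X → ℚ) → ℚ} (c : ℚ) → IsSummation S → (∀ g → E g ≡ c * S g) →
               ∀ m g → sumFun E m g ≡ c ^ m * sumFun S m g
sumFun-scale c L E≡cS zero    g = sym (*-identityˡ _)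
sumFun-scale {S = S} {E} c L E≡cS (suc m) g = begin
  E (λ a → sumFun E m _)             ≡⟨ E≡cS _ ⟩
  c * S (λ a → sumFun E m _)         ≡⟨ cong (c *_) (ext L (λ a → sumFun-scale c L E≡cS m _)) ⟩
  c * S (λ a → c ^ m * sumFun S m _) ≡⟨ cong (c *_) (*-hom L (c ^ m) _) ⟩
  c * (c ^ m * S (λ a → sumFun S m _)) ≡⟨ sym (*-assoc c _ _) ⟩
  c * c ^ m * S (λ a → sumFun S m _)   ∎
  where open ≡-Reasoning

sumFin-const : ∀ m c → sumFin m (λ _ → c) ≡ fromℕ m * c
sumFin-const zero    c = sym (*-zeroˡ c)
sumFin-const (suc m) c = begin
  c + sumFin m (λ _ → c) ≡⟨ cong (_+_ c) (sumFin-const m c) ⟩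
  c + fromℕ m * c        ≡⟨ cong (λ x → x + fromℕ m * c) (sym (*-identityˡ c)) ⟩
  1ℚ * c + fromℕ m * c   ≡⟨ sym (*-distribʳ-+ c 1ℚ (fromℕ m)) ⟩
  (1ℚ + fromℕ m) * c     ≡⟨ cong (_* c) (sym (fromℕ-suc m)) ⟩
  fromℕ (suc m) * c      ∎
  where open ≡-Reasoning

record IsExpectation {X : Set} (E : (X → ℚ) → ℚ) : Set where
  field
    summation : IsSummation E
    const     : ∀ c → E (λ _ → c) ≡ c

open IsExpectation

uniform : ∀ m → (Fin (suc m) → ℚ) → ℚ
uniform m g = + 1 / suc m * sumFin (suc m) g

uniform-isExpectation : ∀ m → IsExpectation (uniform m)
uniform-isExpectation m = record { summation = linear ; const = mass-one }
  where
  v : ℚ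
  v = + 1 / suc m
  Σ-linear : IsSummation (sumFin (suc m))
  Σ-linear = sumFin-isSummation (suc m)
  linear : IsSummation (uniform m)
  ext   linear e      = cong (v *_) (ext Σ-linear e)
  +-hom linear g g'   = trans (cong (v *_) (+-hom Σ-linear g g')) (*-distribˡ-+ v _ _)
  *-hom linear c g    = trans (cong (v *_) (*-hom Σ-linear c g))
                              (trans (sym (*-assoc v c _)) (trans (cong (_* sumFin (suc m) g) (*-comm v c)) (*-assoc c v _)))
  mono  linear le     = *-monoˡ-≤-nonNeg v {{nonNegative (1/n-nonNeg (suc m))}} (mono Σ-linear le)
  mass-one : ∀ c → uniform m (λ _ → c) ≡ c
  mass-one c = begin
    v * sumFin (suc m) (λ _ → c) ≡⟨ cong (v *_) (sumFin-const (suc m) c) ⟩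
    v * (fromℕ (suc m) * c)      ≡⟨ sym (*-assoc v _ c) ⟩
    v * fromℕ (suc m) * c        ≡⟨ cong (_* c) (1/n*n≡1 m) ⟩
    1ℚ * c                       ≡⟨ *-identityˡ c ⟩
    c                            ∎
    where open ≡-Reasoning

sumFun-isExpectation : ∀ {X : Set} {E : (X → ℚ) → ℚ} → IsExpectation E → ∀ m → IsExpectation (sumFun E m)
sumFun-isExpectation P m = record { summation = sumFun-isSummation (summation P) m ; const = mass-one m }
  where
  mass-one : ∀ m c → sumFun _ m (λ _ → c) ≡ c
  mass-one zero    c = refl
  mass-one (suc m) c = trans (ext (summation P) (λ _ → mass-one m c)) (const P c)

module Independence {X : Set} {E : (X → ℚ) → ℚ} (P : IsExpectation E) where

  private
    L : IsSummation E
    L = summation P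
    mass-one : ∀ m c → sumFun E m (λ _ → c) ≡ c
    mass-one m = const (sumFun-isExpectation P m)

  marginal : ∀ m (p : Fin m) (G : X → ℚ) → sumFun E m (λ h → G (h p)) ≡ E G
  marginal (suc m) zero    G = ext L (λ a → mass-one m (G a))
  marginal (suc m) (suc p) G = trans (ext L (λ a → marginal m p G)) (const P (E G))

  pair : ∀ m (p q : Fin m) → p ≢ q → (G : X → X → ℚ) (c : ℚ) →
         (∀ a → E (G a) ≡ c) → (∀ b → E (λ a → G a b) ≡ c) →
         sumFun E m (λ h → G (h p) (h q)) ≡ c
  pair (suc m) zero    zero    p≢q G c rows cols = ⊥-elim (p≢q refl)
  pair (suc m) zero    (suc q) p≢q G c rows cols =
    trans (ext L (λ a → trans (marginal m q (G a)) (rows a))) (const P c)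
  pair (suc m) (suc p) zero    p≢q G c rows cols =
    trans (ext L (λ b → trans (marginal m p (λ a → G a b)) (cols b))) (const P c)
  pair (suc m) (suc p) (suc q) p≢q G c rows cols =
    trans (ext L (λ a → pair m p q (p≢q ∘ cong suc) G c rows cols)) (const P c)

  first-two : ∀ k (A B : X → ℚ) →
              sumFun E (suc (suc k)) (λ H → A (H zero) * B (H (suc zero))) ≡ E A * E B
  first-two k A B = begin
    E (λ a → E (λ b → sumFun E k (λ _ → A a * B b))) ≡⟨ ext L (λ a → ext L (λ b → mass-one k _)) ⟩
    E (λ a → E (λ b → A a * B b))                    ≡⟨ ext L (λ a → *-hom L (A a) B) ⟩
    E (λ a → A a * E B)                              ≡⟨ ext L (λ a → *-comm (A a) (E B)) ⟩
    E (λ a → E B * A a)                              ≡⟨ *-hom L (E B) A ⟩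
    E B * E A                                        ≡⟨ *-comm (E B) (E A) ⟩
    E A * E B                                        ∎
    where open ≡-Reasoning

Bit : ℚ → Set
Bit q = q ≡ 0ℚ ⊎ q ≡ 1ℚ

bit-nonNeg : ∀ {a} → Bit a → 0ℚ ≤ℚ a
bit-nonNeg (inj₁ refl) = ≤-refl
bit-nonNeg (inj₂ refl) = nonNegative⁻¹ 1ℚ

bit-* : ∀ {a b} → Bit a → Bit b → Bit (a * b)
bit-* {b = b} (inj₁ refl) _ = inj₁ (*-zeroˡ b)
bit-* {b = b} (inj₂ refl) β = subst Bit (sym (*-identityˡ b)) β

bit-min : ∀ {a b} p q → Bit a → Bit b → (a * p) ⊓ (b * q) ≤ℚ (p ⊓ q) * (a * b)
bit-min {b = b} p q (inj₁ refl) _ = ≤-trans (p⊓q≤p (0ℚ * p) (b * q))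
  (≤-reflexive (trans (*-zeroˡ p) (sym (trans (cong ((p ⊓ q) *_) (*-zeroˡ b)) (*-zeroʳ (p ⊓ q))))))
bit-min p q (inj₂ refl) (inj₁ refl) = ≤-trans (p⊓q≤q (1ℚ * p) (0ℚ * q))
  (≤-reflexive (trans (*-zeroˡ q) (sym (*-zeroʳ (p ⊓ q)))))
bit-min p q (inj₂ refl) (inj₂ refl) =
  ≤-reflexive (trans (cong₂ _⊓_ (*-identityˡ p) (*-identityˡ q)) (sym (*-identityʳ (p ⊓ q))))

ind-bit : ∀ {m} (a b : Fin m) → Bit (ind a b)
ind-bit zero    zero    = inj₂ refl
ind-bit zero    (suc b) = inj₁ refl
ind-bit (suc a) zero    = inj₁ refl
ind-bit (suc a) (suc b) = ind-bit a b

ind-refl : ∀ {m} (a : Fin m) → ind a a ≡ 1ℚ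
ind-refl zero    = refl
ind-refl (suc a) = ind-refl a

ind-sym : ∀ {m} (a b : Fin m) → ind a b ≡ ind b a
ind-sym zero    zero    = refl
ind-sym zero    (suc b) = refl
ind-sym (suc a) zero    = refl
ind-sym (suc a) (suc b) = ind-sym a b

ind-row : ∀ m (a : Fin m) → sumFin m (ind a) ≡ 1ℚ
ind-row (suc m) zero    = trans (cong (_+_ 1ℚ) (S-zero (sumFin-isSummation m))) (+-identityʳ 1ℚ)
ind-row (suc m) (suc a) = trans (+-identityˡ _) (ind-row m a)

ind≢ : ∀ {m} → Fin m → Fin m → ℚ
ind≢ a b = if does (a ≟ b) then 0ℚ else 1ℚ

ind≢-bit : ∀ {m} (a b : Fin m) → Bit (ind≢ a b)
ind≢-bit a b with a ≟ b
... | yes _ = inj₁ refl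
... | no  _ = inj₂ refl

sumFin-split : ∀ m (i : Fin m) (g : Fin m → ℚ) → sumFin m g ≡ g i + sumFin m (λ j → ind≢ j i * g j)
sumFin-split (suc m) zero g = cong (_+_ (g zero)) (begin
  sumFin m (g ∘ suc)                              ≡⟨ ext (sumFin-isSummation m) (λ j → sym (*-identityˡ (g (suc j)))) ⟩
  sumFin m (λ j → 1ℚ * g (suc j))                 ≡⟨ sym (+-identityˡ _) ⟩
  0ℚ + sumFin m (λ j → 1ℚ * g (suc j))            ≡⟨ cong (_+ sumFin m (λ j → 1ℚ * g (suc j))) (sym (*-zeroˡ (g zero))) ⟩
  0ℚ * g zero + sumFin m (λ j → 1ℚ * g (suc j))   ∎)
  where open ≡-Reasoning
sumFin-split (suc m) (suc i) g = begin
  g zero + sumFin m (g ∘ suc)           ≡⟨ cong (_+_ (g zero)) (sumFin-split m i (g ∘ suc)) ⟩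
  g zero + (g (suc i) + R)              ≡⟨ sym (+-assoc (g zero) _ R) ⟩
  g zero + g (suc i) + R                ≡⟨ cong (_+ R) (+-comm (g zero) (g (suc i))) ⟩
  g (suc i) + g zero + R                ≡⟨ +-assoc (g (suc i)) _ R ⟩
  g (suc i) + (g zero + R)              ≡⟨ cong (λ x → g (suc i) + (x + R)) (sym (*-identityˡ (g zero))) ⟩
  g (suc i) + (1ℚ * g zero + R)         ∎
  where
  open ≡-Reasoning
  R : ℚ
  R = sumFin m (λ j → ind≢ j i * g (suc j))

≤-+-nonNeg : ∀ x y → 0ℚ ≤ℚ y → x ≤ℚ x + y
≤-+-nonNeg x y 0≤y = ≤-trans (≤-reflexive (sym (+-identityʳ x))) (+-monoʳ-≤ x 0≤y)

minFin-≤ : ∀ k (g : Fin (suc k) → ℚ) ℓ → minFin (suc k) g ≤ℚ g ℓ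
minFin-≤ zero    g zero    = ≤-refl
minFin-≤ (suc k) g zero    = p⊓q≤p (g zero) _
minFin-≤ (suc k) g (suc ℓ) = ≤-trans (p⊓q≤q (g zero) _) (minFin-≤ k (g ∘ suc) ℓ)

minFin-glb : ∀ k (g : Fin (suc k) → ℚ) c → (∀ ℓ → c ≤ℚ g ℓ) → c ≤ℚ minFin (suc k) g
minFin-glb zero    g c c≤g = c≤g zero
minFin-glb (suc k) g c c≤g = ⊓-glb (c≤g zero) (minFin-glb k (g ∘ suc) c (c≤g ∘ suc))

minFin-error : ∀ k (S X : Fin (suc (suc k)) → ℚ) c → (∀ ℓ → 0ℚ ≤ℚ X ℓ) → (∀ ℓ → S ℓ ≡ c + X ℓ) →
               ∣ minFin (suc (suc k)) S - c ∣ ≤ℚ X zero ⊓ X (suc zero)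
minFin-error k S X c 0≤X S≡c+X =
  ≤-trans (≤-reflexive (0≤p⇒∣p∣≡p 0≤t-c)) (⊓-glb (t-c≤X zero) (t-c≤X (suc zero)))
  where
  t : ℚ
  t = minFin (suc (suc k)) S
  c≤t : c ≤ℚ t
  c≤t = minFin-glb (suc k) S c (λ ℓ → ≤-trans (≤-+-nonNeg c (X ℓ) (0≤X ℓ)) (≤-reflexive (sym (S≡c+X ℓ))))
  0≤t-c : 0ℚ ≤ℚ t - c
  0≤t-c = ≤-trans (≤-reflexive (sym (+-inverseʳ c))) (+-monoˡ-≤ (- c) c≤t)
  t-c≤X : ∀ ℓ → t - c ≤ℚ X ℓ
  t-c≤X ℓ = begin
    t - c         ≤⟨ +-monoˡ-≤ (- c) (≤-trans (minFin-≤ (suc k) S ℓ) (≤-reflexive (S≡c+X ℓ))) ⟩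
    c + X ℓ - c   ≡⟨ cong (_- c) (+-comm c (X ℓ)) ⟩
    X ℓ + c - c   ≡⟨ +-assoc (X ℓ) c (- c) ⟩
    X ℓ + (c - c) ≡⟨ cong (_+_ (X ℓ)) (+-inverseʳ c) ⟩
    X ℓ + 0ℚ      ≡⟨ +-identityʳ (X ℓ) ⟩
    X ℓ           ∎
    where open ≤-Reasoning

⊓-subadditive : ∀ a b c → 0ℚ ≤ℚ a → 0ℚ ≤ℚ b → 0ℚ ≤ℚ c → c ⊓ (a + b) ≤ℚ c ⊓ a + c ⊓ b
⊓-subadditive a b c 0≤a 0≤b 0≤c with ≤-total c a | ≤-total c b
... | inj₁ c≤a | _        = begin
  c ⊓ (a + b)   ≤⟨ p⊓q≤p c _ ⟩
  c             ≡⟨ sym (p≤q⇒p⊓q≡p c≤a) ⟩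
  c ⊓ a         ≤⟨ ≤-+-nonNeg (c ⊓ a) (c ⊓ b) (⊓-glb 0≤c 0≤b) ⟩
  c ⊓ a + c ⊓ b ∎
  where open ≤-Reasoning
... | inj₂ a≤c | inj₁ c≤b = begin
  c ⊓ (a + b)   ≤⟨ p⊓q≤p c _ ⟩
  c             ≤⟨ ≤-+-nonNeg c a 0≤a ⟩
  c + a         ≡⟨ +-comm c a ⟩
  a + c         ≡⟨ cong₂ _+_ (sym (p≥q⇒p⊓q≡q a≤c)) (sym (p≤q⇒p⊓q≡p c≤b)) ⟩
  c ⊓ a + c ⊓ b ∎
  where open ≤-Reasoning
... | inj₂ a≤c | inj₂ b≤c = begin
  c ⊓ (a + b)   ≤⟨ p⊓q≤q c _ ⟩
  a + b         ≡⟨ cong₂ _+_ (sym (p≥q⇒p⊓q≡q a≤c)) (sym (p≥q⇒p⊓q≡q b≤c)) ⟩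
  c ⊓ a + c ⊓ b ∎
  where open ≤-Reasoning

⊓-sumFin : ∀ m c (v : Fin m → ℚ) → 0ℚ ≤ℚ c → (∀ j → 0ℚ ≤ℚ v j) →
           c ⊓ sumFin m v ≤ℚ sumFin m (λ j → c ⊓ v j)
⊓-sumFin zero    c v 0≤c 0≤v = p⊓q≤q c 0ℚ
⊓-sumFin (suc m) c v 0≤c 0≤v =
  ≤-trans (⊓-subadditive (v zero) _ c (0≤v zero) (S-nonNeg (sumFin-isSummation m) (0≤v ∘ suc)) 0≤c)
          (+-monoʳ-≤ (c ⊓ v zero) (⊓-sumFin m c (v ∘ suc) 0≤c (0≤v ∘ suc)))

sumFin-⊓-sumFin : ∀ m (u v : Fin m → ℚ) → (∀ j → 0ℚ ≤ℚ u j) → (∀ j → 0ℚ ≤ℚ v j) →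
                  sumFin m u ⊓ sumFin m v ≤ℚ sumFin m (λ j → sumFin m (λ j' → u j ⊓ v j'))
sumFin-⊓-sumFin m u v 0≤u 0≤v = begin
  sumFin m u ⊓ sumFin m v                        ≡⟨ ⊓-comm (sumFin m u) _ ⟩
  sumFin m v ⊓ sumFin m u                        ≤⟨ ⊓-sumFin m _ u (S-nonNeg Σ-linear 0≤v) 0≤u ⟩
  sumFin m (λ j → sumFin m v ⊓ u j)              ≡⟨ ext Σ-linear (λ j → ⊓-comm _ (u j)) ⟩
  sumFin m (λ j → u j ⊓ sumFin m v)              ≤⟨ mono Σ-linear (λ j → ⊓-sumFin m (u j) v (0≤u j) 0≤v) ⟩
  sumFin m (λ j → sumFin m (λ j' → u j ⊓ v j')) ∎
  where
  open ≤-Reasoning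
  Σ-linear : IsSummation (sumFin m)
  Σ-linear = sumFin-isSummation m

ind≤ : ℕ → ℕ → ℚ
ind≤ zero    b       = 1ℚ
ind≤ (suc a) zero    = 0ℚ
ind≤ (suc a) (suc b) = ind≤ a b

ind≤-bit : ∀ a b → Bit (ind≤ a b)
ind≤-bit zero    b       = inj₂ refl
ind≤-bit (suc a) zero    = inj₁ refl
ind≤-bit (suc a) (suc b) = ind≤-bit a b

ind≤-true : ∀ {a b} → a ≤ b → ind≤ a b ≡ 1ℚ
ind≤-true ℕ.z≤n       = refl
ind≤-true (ℕ.s≤s a≤b) = ind≤-true a≤b

count-≤ : ∀ m t → sumFin m (λ j → ind≤ (toℕ j) t) ≤ℚ fromℕ (suc t)
count-≤ zero    t       = fromℕ-nonNeg (suc t)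
count-≤ (suc m) zero    =
  ≤-reflexive (trans (cong (_+_ 1ℚ) (S-zero (sumFin-isSummation m))) (+-identityʳ 1ℚ))
count-≤ (suc m) (suc t) =
  ≤-trans (+-monoʳ-≤ 1ℚ (count-≤ m t)) (≤-reflexive (sym (fromℕ-suc (suc t))))

f-nonNeg : ∀ {m} (j : Fin m) → 0ℚ ≤ℚ f j
f-nonNeg j = 1/n-nonNeg (suc (toℕ j))

ind≤-f-nonNeg : ∀ {m} (j j' : Fin m) → 0ℚ ≤ℚ ind≤ (toℕ j') (toℕ j) * f j
ind≤-f-nonNeg j j' = *-nonNeg (bit-nonNeg (ind≤-bit (toℕ j') (toℕ j))) (f-nonNeg j)

f-⊓-≤ : ∀ {m} (j j' : Fin m) → toℕ j' ≤ toℕ j → f j ⊓ f j' ≤ℚ ind≤ (toℕ j') (toℕ j) * f j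
f-⊓-≤ j j' j'≤j = ≤-trans (p⊓q≤p (f j) (f j'))
  (≤-reflexive (sym (trans (cong (_* f j) (ind≤-true j'≤j)) (*-identityˡ (f j)))))

f-⊓ : ∀ {m} (j j' : Fin m) → f j ⊓ f j' ≤ℚ ind≤ (toℕ j') (toℕ j) * f j + ind≤ (toℕ j) (toℕ j') * f j'
f-⊓ j j' with ℕP.≤-total (toℕ j') (toℕ j)
... | inj₁ j'≤j = ≤-trans (f-⊓-≤ j j' j'≤j) (≤-+-nonNeg _ _ (ind≤-f-nonNeg j' j))
... | inj₂ j≤j' = begin
  f j ⊓ f j'                           ≡⟨ ⊓-comm (f j) (f j') ⟩
  f j' ⊓ f j                           ≤⟨ f-⊓-≤ j' j j≤j' ⟩
  ind≤ (toℕ j) (toℕ j') * f j'         ≤⟨ ≤-+-nonNeg _ _ (ind≤-f-nonNeg j j') ⟩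
  ind≤ (toℕ j) (toℕ j') * f j' + ind≤ (toℕ j') (toℕ j) * f j ≡⟨ +-comm (ind≤ (toℕ j) (toℕ j') * f j') _ ⟩
  ind≤ (toℕ j') (toℕ j) * f j + ind≤ (toℕ j) (toℕ j') * f j' ∎
  where open ≤-Reasoning

-- Σ_{j,j' < m} min (f j) (f j') ≤ 2m: each pair is charged to its larger index j, and
-- index j receives at most (j + 1) · f j = 1 from each of the two orders.
harmonic-⊓ : ∀ m → sumFin m (λ j → sumFin m (λ j' → f j ⊓ f j')) ≤ℚ fromℕ m + fromℕ m
harmonic-⊓ m = begin
  sumFin m (λ j → sumFin m (λ j' → f j ⊓ f j'))             ≤⟨ mono Σ (λ j → mono Σ (f-⊓ j)) ⟩
  sumFin m (λ j → sumFin m (λ j' → w j j' + w j' j))        ≡⟨ ext Σ (λ j → +-hom Σ (w j) (λ j' → w j' j)) ⟩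
  sumFin m (λ j → sumFin m (w j) + sumFin m (λ j' → w j' j)) ≡⟨ +-hom Σ _ _ ⟩
  A + sumFin m (λ j → sumFin m (λ j' → w j' j))              ≡⟨ cong (_+_ A) (S-sumFin Σ m w) ⟩
  A + A                                                      ≤⟨ +-mono-≤ A≤m A≤m ⟩
  fromℕ m + fromℕ m                                          ∎
  where
  open ≤-Reasoning
  Σ : IsSummation (sumFin m)
  Σ = sumFin-isSummation m
  w : Fin m → Fin m → ℚ
  w j j' = ind≤ (toℕ j') (toℕ j) * f j
  A : ℚ
  A = sumFin m (λ j → sumFin m (w j))
  charge≤1 : ∀ j → sumFin m (w j) ≤ℚ 1ℚ
  charge≤1 j = begin
    sumFin m (w j)                                   ≡⟨ ext Σ (λ j' → *-comm _ (f j)) ⟩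
    sumFin m (λ j' → f j * ind≤ (toℕ j') (toℕ j))    ≡⟨ *-hom Σ (f j) _ ⟩
    f j * sumFin m (λ j' → ind≤ (toℕ j') (toℕ j))    ≤⟨ *-monoˡ-≤-nonNeg (f j) {{nonNegative (f-nonNeg j)}} (count-≤ m (toℕ j)) ⟩
    f j * fromℕ (suc (toℕ j))                        ≡⟨ 1/n*n≡1 (toℕ j) ⟩
    1ℚ                                               ∎
  A≤m : A ≤ℚ fromℕ m
  A≤m = ≤-trans (mono Σ charge≤1) (≤-reflexive (trans (sumFin-const m 1ℚ) (*-identityʳ (fromℕ m))))

hashExpectation : ∀ m k → ((Fin k → Fin (suc m) → Fin (suc m)) → ℚ) → ℚ
hashExpectation m k = sumFun (sumFun (uniform m) (suc m)) k

hashExpectation-isExpectation : ∀ m k → IsExpectation (hashExpectation m k)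
hashExpectation-isExpectation m k =
  sumFun-isExpectation (sumFun-isExpectation (uniform-isExpectation m) (suc m)) k

normalised≡hashExpectation : ∀ m k (G : (Fin k → Fin (suc m) → Fin (suc m)) → ℚ) →
  (+ 1 / (suc m ℕ.^ (suc m ℕ.* k))) {{ℕP.m^n≢0 (suc m) (suc m ℕ.* k)}} * sumHashes (suc m) k G
    ≡ hashExpectation m k G
normalised≡hashExpectation m k G = sym (begin
  hashExpectation m k G          ≡⟨ sumFun-scale (v ^ n) (sumFun-isSummation (sumFin-isSummation n) n) one-hash k G ⟩
  (v ^ n) ^ k * sumHashes n k G  ≡⟨ cong (_* sumHashes n k G) (^-assocʳ v n k) ⟩
  v ^ (n ℕ.* k) * sumHashes n k G ≡⟨ cong (_* sumHashes n k G) (1/n^e n (n ℕ.* k)) ⟩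
  (+ 1 / (n ℕ.^ (n ℕ.* k))) {{ℕP.m^n≢0 n (n ℕ.* k)}} * sumHashes n k G ∎)
  where
  open ≡-Reasoning
  n : ℕ
  n = suc m
  v : ℚ
  v = + 1 / n
  one-hash : ∀ g → sumFun (uniform m) n g ≡ v ^ n * sumHash n g
  one-hash = sumFun-scale v (sumFin-isSummation n) (λ _ → refl) n

module ErrorBound (m k' : ℕ) (i : Fin (suc m)) where

  n k : ℕ
  n = suc m
  k = suc (suc k')

  v : ℚ
  v = + 1 / n

  Σ : IsSummation (sumFin n)
  Σ = sumFin-isSummation n

  collide : (Fin n → Fin n) → Fin n → ℚ
  collide h j = ind≢ j i * ind (h j) (h i)

  collide-bit : ∀ h j → Bit (collide h j)
  collide-bit h j = bit-* (ind≢-bit j i) (ind-bit (h j) (h i))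

  pairTerm : Fin n → Fin n → (Fin k → Fin n → Fin n) → ℚ
  pairTerm j j' H = (f j ⊓ f j') * (collide (H zero) j * collide (H (suc zero)) j')

  -- Pointwise error bound: every row ℓ overestimates f i by X ℓ = Σ_j collide(h_ℓ, j) f j ≥ 0,
  -- so the error is at most min (X 0) (X 1), which is bounded by the double sum of pair terms.
  error-pointwise : ∀ H → ∣ ftilde n k H i - f i ∣ ≤ℚ sumFin n (λ j → sumFin n (λ j' → pairTerm j j' H))
  error-pointwise H = begin
    ∣ ftilde n k H i - f i ∣                          ≤⟨ minFin-error k' S X (f i) X-nonNeg S≡f+X ⟩
    X zero ⊓ X (suc zero)                             ≤⟨ sumFin-⊓-sumFin n _ _ (u-nonNeg zero) (u-nonNeg (suc zero)) ⟩
    sumFin n (λ j → sumFin n (λ j' → u zero j ⊓ u (suc zero) j'))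
      ≤⟨ mono Σ (λ j → mono Σ (λ j' → bit-min (f j) (f j') (collide-bit (H zero) j) (collide-bit (H (suc zero)) j'))) ⟩
    sumFin n (λ j → sumFin n (λ j' → pairTerm j j' H)) ∎
    where
    open ≤-Reasoning
    S : Fin k → ℚ
    S ℓ = sumFin n (λ j → ind (H ℓ j) (H ℓ i) * f j)
    u : Fin k → Fin n → ℚ
    u ℓ j = collide (H ℓ) j * f j
    X : Fin k → ℚ
    X ℓ = sumFin n (u ℓ)
    u-nonNeg : ∀ ℓ j → 0ℚ ≤ℚ u ℓ j
    u-nonNeg ℓ j = *-nonNeg (bit-nonNeg (collide-bit (H ℓ) j)) (f-nonNeg j)
    X-nonNeg : ∀ ℓ → 0ℚ ≤ℚ X ℓ
    X-nonNeg ℓ = S-nonNeg Σ (u-nonNeg ℓ)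
    S≡f+X : ∀ ℓ → S ℓ ≡ f i + X ℓ
    S≡f+X ℓ = trans (sumFin-split n i (λ j → ind (H ℓ j) (H ℓ i) * f j)) (cong₂ _+_
      (trans (cong (_* f i) (ind-refl (H ℓ i))) (*-identityˡ (f i)))
      (ext Σ (λ j → sym (*-assoc (ind≢ j i) (ind (H ℓ j) (H ℓ i)) (f j)))))

  E₁ : ((Fin n → Fin n) → ℚ) → ℚ
  E₁ = sumFun (uniform m) n

  P₁ : IsExpectation E₁
  P₁ = sumFun-isExpectation (uniform-isExpectation m) n

  collision-probability : ∀ j → j ≢ i → E₁ (λ h → ind (h j) (h i)) ≡ v
  collision-probability j j≢i = Independence.pair (uniform-isExpectation m) n j i j≢i ind v row col
    where
    row : ∀ a → uniform m (ind a) ≡ v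
    row a = trans (cong (v *_) (ind-row n a)) (*-identityʳ v)
    col : ∀ b → uniform m (λ a → ind a b) ≡ v
    col b = trans (ext (summation (uniform-isExpectation m)) (λ a → ind-sym a b)) (row b)

  collide-mean-nonNeg : ∀ j → 0ℚ ≤ℚ E₁ (λ h → collide h j)
  collide-mean-nonNeg j = S-nonNeg (summation P₁) (λ h → bit-nonNeg (collide-bit h j))

  collide-mean-≤ : ∀ j → E₁ (λ h → collide h j) ≤ℚ v
  collide-mean-≤ j = ≤-trans (≤-reflexive (*-hom (summation P₁) (ind≢ j i) (λ h → ind (h j) (h i)))) (weighted j)
    where
    weighted : ∀ j → ind≢ j i * E₁ (λ h → ind (h j) (h i)) ≤ℚ v
    weighted j with j ≟ i
    ... | yes _   = ≤-trans (≤-reflexive (*-zeroˡ (E₁ (λ h → ind (h j) (h i))))) (1/n-nonNeg n)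
    ... | no  j≢i = ≤-reflexive (trans (*-identityˡ (E₁ (λ h → ind (h j) (h i)))) (collision-probability j j≢i))

  -- The two hash functions are independent, so each pair term has mean at most min (f j) (f j') / n².
  pairTerm-mean : ∀ j j' → hashExpectation m k (pairTerm j j') ≤ℚ (f j ⊓ f j') * (v * v)
  pairTerm-mean j j' = begin
    hashExpectation m k (pairTerm j j')
      ≡⟨ *-hom (summation (hashExpectation-isExpectation m k)) (f j ⊓ f j') (λ H → collide (H zero) j * collide (H (suc zero)) j') ⟩
    (f j ⊓ f j') * hashExpectation m k (λ H → collide (H zero) j * collide (H (suc zero)) j')
      ≡⟨ cong ((f j ⊓ f j') *_) (Independence.first-two P₁ k' (λ h → collide h j) (λ h → collide h j')) ⟩
    (f j ⊓ f j') * (E₁ (λ h → collide h j) * E₁ (λ h → collide h j'))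
      ≤⟨ *-monoˡ-≤-nonNeg (f j ⊓ f j') {{nonNegative (⊓-glb (f-nonNeg j) (f-nonNeg j'))}}
           (*-mono-nonNeg (collide-mean-nonNeg j) (collide-mean-≤ j) (collide-mean-nonNeg j') (collide-mean-≤ j')) ⟩
    (f j ⊓ f j') * (v * v) ∎
    where open ≤-Reasoning

  expected-error : expErr n k i ≤ℚ + 2 / n
  expected-error = begin
    expErr n k i
      ≡⟨ normalised≡hashExpectation m k (λ H → ∣ ftilde n k H i - f i ∣) ⟩
    E (λ H → ∣ ftilde n k H i - f i ∣)
      ≤⟨ mono Eₖ error-pointwise ⟩
    E (λ H → sumFin n (λ j → sumFin n (λ j' → pairTerm j j' H)))
      ≡⟨ S-sumFin Eₖ n (λ j H → sumFin n (λ j' → pairTerm j j' H)) ⟩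
    sumFin n (λ j → E (λ H → sumFin n (λ j' → pairTerm j j' H)))
      ≡⟨ ext Σ (λ j → S-sumFin Eₖ n (pairTerm j)) ⟩
    sumFin n (λ j → sumFin n (λ j' → E (pairTerm j j')))
      ≤⟨ mono Σ (λ j → mono Σ (pairTerm-mean j)) ⟩
    sumFin n (λ j → sumFin n (λ j' → (f j ⊓ f j') * (v * v)))
      ≡⟨ ext Σ (λ j → trans (ext Σ (λ j' → *-comm (f j ⊓ f j') (v * v))) (*-hom Σ (v * v) (λ j' → f j ⊓ f j'))) ⟩
    sumFin n (λ j → (v * v) * sumFin n (λ j' → f j ⊓ f j'))
      ≡⟨ *-hom Σ (v * v) (λ j → sumFin n (λ j' → f j ⊓ f j')) ⟩
    (v * v) * sumFin n (λ j → sumFin n (λ j' → f j ⊓ f j'))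
      ≤⟨ *-monoˡ-≤-nonNeg (v * v) {{nonNegative (*-nonNeg (1/n-nonNeg n) (1/n-nonNeg n))}} (harmonic-⊓ n) ⟩
    (v * v) * (fromℕ n + fromℕ n)
      ≡⟨ 1/n²*2n≡2/n m ⟩
    + 2 / n ∎
    where
    open ≤-Reasoning
    E : ((Fin k → Fin n → Fin n) → ℚ) → ℚ
    E = hashExpectation m k
    Eₖ : IsSummation E
    Eₖ = summation (hashExpectation-isExpectation m k)

lemma3p2 : ∃ λ (C : ℕ) → ∀ (n k : ℕ) .{{_ : NonZero n}} → 2 ≤ k → (i : Fin n) →
    expErr n k i ≤ℚ (+ C) / n
lemma3p2 = 2 , bound
  where
  bound : ∀ (n k : ℕ) .{{_ : NonZero n}} → 2 ≤ k → (i : Fin n) → expErr n k i ≤ℚ + 2 / n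
  bound (suc m) (suc (suc k')) _             i = ErrorBound.expected-error m k' i
  bound (suc m) (suc zero)     (ℕ.s≤s ()) i
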